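{- Fix positive integers $r,n$ and disjoint vertex sets $O=\{o_1,\ldots,o_r\}$ and $V=\{v_1,\ldots,v_n\}$. The map $\Psi_n^r$ from the set of regions of the $r$-Shi arrangement $\mathcal{S}_n^r$ to the set $\mathcal{T}_n^r$ of $O$-rooted labeled $r$-trees on $O\cup V$, given by $\Psi_n^r(\Delta)=T_{\bm x}$ for any ${\bm x}\in\Delta$, is injective.
   Context: The $r$-Shi arrangement $\mathcal{S}_n^r$ in $\mathbb{R}^n$ consists of the hyperplanes $x_i-x_j=a$ for $1\le i<j\le n$ and $a\in\{ -r+1,\ldots,r\}$. Its regions are the connected components of the complement of their union. For ${\bm x}\in\mathbb{R}^n$, the cubic matrix $C_{\bm x}=(c_{ijk}({\bm x}))$, with $i,j\in[n]$ and $k\in[r]$, is defined by - $c_{ijk}=x_i-x_j-k$ if $i<j$; - $c_{ijk}=0$ if $i=j$; - $c_{ijk}=x_i-x_j-k+1$ if $i>j$. For ${\bm x}$ in a region and each $j\in[n]$, define $f(v_j)\in(O\cup V)^r$ recursively: - (i) if all entries of the $j$-th column slice $(c_{ijk}({\bm x}))_{i,k}$ are $\le0$, put $p_j=0$ and $f(v_j)=(o_1,\ldots,o_r)$; - (ii) otherwise let $(p_j,q_j)$ be the position of the unique minimal positive entry of that slice, and set \[f(v_j)=(f_1(v_{p_j}),\ldots,f_{q_j-1}(v_{p_j}),f_{q_j+1}(v_{p_j}),\ldots,f_r(v_{p_j}),v_{p_j}).\] Let $F(v_j)=\{f_i(v_j)\}$. $T_{\bm x}$ is the graph on $O\cup V$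 in which $\{v_j\}\cup F(v_j)$ is a clique for each $j$ (and no other edges). $T_{\bm x}$ is independent of ${\bm x}$ in the region and is an $O$-rooted labeled $r$-tree. An $O$-rooted labeled $r$-tree is a graph on $O\cup V$ admitting an ordering $(v_{i_1},\ldots,v_{i_n})$ of $V$ such that each $v_{i_j}$ is adjacent to exactly $r$ vertices of $\{o_1,\ldots,o_r,v_{i_1},\ldots,v_{i_{j-1}}\}$, and these $r$ vertices are mutually adjacent.
   Formalization: The points ${\bm x}$ lying in regions of $\mathcal{S}_n^r$ are taken in ℚ^n rather than $\mathbb{R}^n$. -}

module Defs where

open import Data.Nat using (ℕ; zero; suc)
import Data.Nat
open import Data.Integer as ℤ using (ℤ; +_)
open import Data.Rational using (ℚ; _+_; _-_; _<_; _≤_; 0ℚ) renaming (_/_ to _÷_)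
open import Data.Rational.Properties using (_<?_; _≤?_)
open import Data.Fin as Fin using (Fin; toℕ)
import Data.Fin.Properties as FinP
open import Data.Vec using (Vec; removeAt; _∷ʳ_; tabulate; lookup; toList)
open import Data.List using (List; []; _∷_; allFin; cartesianProduct)
open import Data.Maybe using (Maybe; just; nothing)
open import Data.Product using (_×_; _,_; ∃; ∃-syntax)
open import Data.Sum using (_⊎_; inj₁; inj₂)
open import Relation.Nullary using (¬_; yes; no)
open import Relation.Nullary.Decidable using (⌊_⌋)
open import Relation.Binary.PropositionalEquality using (_≡_)
open import Data.List.Membership.Propositional using (_∈_)
open import Function.Bundles using (_⇔_)

ℤtoℚ : ℤ → ℚ
ℤtoℚ a = a ÷ 1

ℕtoℚ : ℕ → ℚ
ℕtoℚ m = (+ m) ÷ 1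

Point : ℕ → Set
Point n = Fin n → ℚ

-- The r-Shi arrangement S_n^r : hyperplanes x_i - x_j = a, i < j,
-- a ∈ {-r+1, …, r}, i.e. -r < a ≤ r.

IsShiHyperplane : (r : ℕ) → ℤ → Set
IsShiHyperplane r a = (ℤ.- (+ r)) ℤ.< a × a ℤ.≤ (+ r)

InComplement : (r n : ℕ) → Point n → Set
InComplement r n x =
  ∀ (i j : Fin n) → i Fin.< j → ∀ (a : ℤ) → IsShiHyperplane r a →
    ¬ (x i - x j ≡ ℤtoℚ a)

SameRegion : (r n : ℕ) → Point n → Point n → Set
SameRegion r n x y =
  ∀ (i j : Fin n) → i Fin.< j → ∀ (a : ℤ) → IsShiHyperplane r a →
    (x i - x j < ℤtoℚ a) ⇔ (y i - y j < ℤtoℚ a)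

-- The cubic matrix C_x.  Index k : Fin r stands for k+1 ∈ [r].

c : (r n : ℕ) → Point n → Fin n → Fin n → Fin r → ℚ
c r n x i j k with toℕ i Data.Nat.<? toℕ j | toℕ j Data.Nat.<? toℕ i
... | yes _ | _     = x i - x j - ℕtoℚ (suc (toℕ k))
... | no _  | yes _ = x i - x j - ℕtoℚ (suc (toℕ k)) + ℕtoℚ 1
... | no _  | no _  = 0ℚ

-- position of the minimal positive entry among a list of positions
-- (ties broken towards the earlier one; for points of a region the
-- minimum is unique, so this choice is irrelevant there).
minPos : {A : Set} → (A → ℚ) → List A → Maybe A
minPos g [] = nothing
minPos g (a ∷ as) with minPos g as
... | nothing with 0ℚ <? g a
...   | yes _ = just a
...   | no _  = nothing
minPos g (a ∷ as) | just b with 0ℚ <? g a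
...   | no _ = just b
...   | yes _ with g a ≤? g b
...     | yes _ = just a
...     | no _  = just b

minimalPositive : (r n : ℕ) → Point n → Fin n → Maybe (Fin n × Fin r)
minimalPositive r n x j =
  minPos (λ pk → c r n x (Data.Product.proj₁ pk) j (Data.Product.proj₂ pk))
         (cartesianProduct (allFin n) (allFin r))

-- Vertices: O ⊎ V, o_t = inj₁ t, v_j = inj₂ j.

Vertex : ℕ → ℕ → Set
Vertex r n = Fin r ⊎ Fin n

os : (r n : ℕ) → Vec (Vertex r n) r
os r n = tabulate inj₁

shiftIn : ∀ {A : Set} (r : ℕ) → Vec A r → Fin r → A → Vec A r
shiftIn (suc r) v q a = removeAt v q ∷ʳ a

-- f with fuel; the chain j, p_j, p_{p_j}, … has strictly increasing
-- coordinates (a positive entry c_{pjk} forces x_p > x_j), hence consists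
-- of distinct indices, so fuel n always suffices.
fFuel : (r n : ℕ) → Point n → ℕ → Fin n → Vec (Vertex r n) r
fFuel r n x zero j = os r n
fFuel r n x (suc fuel) j with minimalPositive r n x j
... | nothing      = os r n
... | just (p , q) = shiftIn r (fFuel r n x fuel p) q (inj₂ p)

f : (r n : ℕ) → Point n → Fin n → Vec (Vertex r n) r
f r n x j = fFuel r n x n j

Clique : (r n : ℕ) → Point n → Fin n → Vertex r n → Set
Clique r n x j u = (u ≡ inj₂ j) ⊎ (u ∈ toList (f r n x j))

Edge : (r n : ℕ) → Point n → Vertex r n → Vertex r n → Set
Edge r n x u w = ¬ (u ≡ w) × ∃[ j ] (Clique r n x j u × Clique r n x j w)

SameGraph : (r n : ℕ) → Point n → Point n → Set
SameGraph r n x y = ∀ (u w : Vertex r n) → Edge r n x u w ⇔ Edge r n y u w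

{-# OPTIONS --safe #-}
-- The tree T_x determines the vectors f(v_j), and these determine the region of x.
-- Removing F(v_j) cuts v_j off from O: a path avoiding F(v_j) only visits descendants
-- of v_j. Conversely, if every member above v_j of a set S lies in F(v_j), then from
-- any vertex of F(v_j) outside S one escapes to O avoiding S through ever higher
-- vertices. Hence two points with the same tree have the same sets F(v_j); since f(v_j)
-- is f(v_{p_j}) with its q_j-th entry dropped and v_{p_j} appended, induction along
-- parents recovers p_j, q_j and f. Finally c_{p_j j k} > 0 iff k ≤ q_j, and for
-- i ≠ p_j, c_{ijk} > 0 iff c_{ijk} > c_{p_j j q_j}. By genericity the latter is a
-- strict comparison x_{p_j} + A < x_i + B across a hyperplane of the arrangement, so it
-- is decided by the signs in the column slices of p_j and i, by induction on ranks.
-- Every side x_i - x_j < a of a hyperplane is such a comparison.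
module Submission where

open import Defs

open import Data.Empty using (⊥; ⊥-elim)
open import Data.Fin as Fin using (Fin; zero; suc; toℕ; punchOut)
import Data.Fin.Properties as Finₚ
open import Data.Integer as ℤ using (ℤ; +_; -[1+_])
import Data.Integer.Properties as ℤₚ
open import Data.List as List using (List; []; _∷_; allFin; cartesianProduct)
open import Data.List.Membership.Propositional using (_∈_; _∉_; find)
open import Data.List.Membership.Propositional.Properties
  using (∈-++⁻; ∈-++⁺ˡ; ∈-++⁺ʳ; ∈-cartesianProduct⁺; ∈-allFin)
import Data.List.Membership.DecPropositional as DecMembership
open import Data.List.Relation.Binary.Subset.Propositional using (_⊆_)
open import Data.List.Relation.Unary.All as All using (All; []; _∷_; all?)
open import Data.List.Relation.Unary.All.Properties using (¬All⇒Any¬)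
open import Data.List.Relation.Unary.Any using (here; there)
open import Data.List.Relation.Unary.Unique.Propositional using (Unique; []; _∷_)
import Data.List.Relation.Unary.Unique.Propositional.Properties as Uniqueₚ
open import Data.Maybe using (Maybe; just; nothing)
open import Data.Nat as ℕ using (ℕ; zero; suc; z≤n; s≤s)
open import Data.Nat.Coprimality using (1-coprimeTo) renaming (sym to Coprime-sym)
open import Data.Nat.Induction using (<-wellFounded)
import Data.Nat.Properties as ℕₚ
import Data.Nat.Solver as ℕ-Solver
open import Data.Product as Product using (Σ; ∃; ∃₂; _×_; _,_; proj₁; proj₂)
open import Data.Rational as ℚ using (ℚ; 0ℚ; _+_; _-_; -_; _<_; _≤_; _≮_)
import Data.Rational.Properties as ℚₚ
open import Data.Rational.Solver using (module +-*-Solver)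
open import Data.Sum using (_⊎_; inj₁; inj₂)
open import Data.Sum.Properties using (≡-dec; inj₁-injective; inj₂-injective)
open import Data.Unit using (⊤; tt)
open import Data.Vec as Vec using (Vec; []; _∷_; _∷ʳ_; lookup; removeAt; toList)
open import Data.Vec.Membership.Propositional.Properties using (∈-lookup; ∈-toList⁺; ∈-toList⁻)
import Data.Vec.Properties as Vecₚ
import Data.Vec.Relation.Unary.Any as Anyᵥ
open import Data.Vec.Relation.Unary.Any.Properties using (lookup-index)
open import Function using (_∘_; _⇔_; mk⇔; Equivalence)
import Function.Properties.Equivalence as ⇔
import Relation.Binary.Reasoning.Setoid as SetoidReasoning
open import Induction.WellFounded using (WellFounded; Acc; acc; module Subrelation)
open import Level using (0ℓ)
open import Relation.Binary.Core using (Rel)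
open import Relation.Binary.Definitions using (tri<; tri≈; tri>; DecidableEquality)
open import Relation.Binary.Construct.Closure.ReflexiveTransitive as Star using (Star; ε; _◅_; _◅◅_)
import Relation.Binary.Construct.On as On
open import Relation.Binary.PropositionalEquality
open import Relation.Nullary using (¬_; Dec; yes; no; contradiction)
open import Relation.Unary using (Pred; Decidable)
open import Relation.Unary.Properties using (U?)

module ⇔-Reasoning = SetoidReasoning (⇔.⇔-setoid 0ℓ)

module _ where
  open +-*-Solver

  private
    p+q-q≡p : ∀ p q → p + q - q ≡ p
    p+q-q≡p = solve 2 (λ p q → p :+ q :- q := p) refl

  +-cancelʳ-< : ∀ s {p q} → p + s < q + s → p < q
  +-cancelʳ-< s {p} {q} lt = subst₂ _<_ (p+q-q≡p p s) (p+q-q≡p q s) (ℚₚ.+-monoˡ-< (- s) lt)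

  +-cancelʳ-≤ : ∀ s {p q} → p + s ≤ q + s → p ≤ q
  +-cancelʳ-≤ s {p} {q} le = subst₂ _≤_ (p+q-q≡p p s) (p+q-q≡p q s) (ℚₚ.+-monoˡ-≤ (- s) le)

  <-+ʳ : ∀ s {p q} → p < q ⇔ p + s < q + s
  <-+ʳ s = mk⇔ (ℚₚ.+-monoˡ-< s) (+-cancelʳ-< s)

  ≤-+ʳ : ∀ s {p q} → p ≤ q ⇔ p + s ≤ q + s
  ≤-+ʳ s = mk⇔ (ℚₚ.+-monoˡ-≤ s) (+-cancelʳ-≤ s)

  0<p-q⇔q<p : ∀ p q → 0ℚ < p - q ⇔ q < p
  0<p-q⇔q<p p q = begin
    0ℚ < p - q         ≈⟨ <-+ʳ q ⟩
    0ℚ + q < p - q + q ≡⟨ cong₂ _<_ (ℚₚ.+-identityˡ q) (solve 2 (λ p q → p :- q :+ q := p) refl p q) ⟩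
    q < p              ∎
    where open ⇔-Reasoning

  p-q≤p′-q′⇔p+q′≤p′+q : ∀ p q p′ q′ → p - q ≤ p′ - q′ ⇔ p + q′ ≤ p′ + q
  p-q≤p′-q′⇔p+q′≤p′+q p q p′ q′ = begin
    p - q ≤ p′ - q′                         ≈⟨ ≤-+ʳ (q + q′) ⟩
    p - q + (q + q′) ≤ p′ - q′ + (q + q′)   ≡⟨ cong₂ _≤_ (solve 3 (λ p q q′ → p :- q :+ (q :+ q′) := p :+ q′) refl p q q′)
                                                         (solve 3 (λ p′ q q′ → p′ :- q′ :+ (q :+ q′) := p′ :+ q) refl p′ q q′) ⟩
    p + q′ ≤ p′ + q                         ∎
    where open ⇔-Reasoning

  p-q<s-t⇔p+t<q+s : ∀ p q s t → p - q < s - t ⇔ p + t < q + s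
  p-q<s-t⇔p+t<q+s p q s t = begin
    p - q < s - t                    ≈⟨ <-+ʳ (q + t) ⟩
    p - q + (q + t) < s - t + (q + t) ≡⟨ cong₂ _<_ (solve 3 (λ p q t → p :- q :+ (q :+ t) := p :+ t) refl p q t)
                                                   (solve 3 (λ q s t → s :- t :+ (q :+ t) := q :+ s) refl q s t) ⟩
    p + t < q + s                    ∎
    where open ⇔-Reasoning

  v+s≡u+t⇒u-v≡s-t : ∀ u v s t → v + s ≡ u + t → u - v ≡ s - t
  v+s≡u+t⇒u-v≡s-t u v s t v+s≡u+t = begin
    u - v                     ≡⟨ solve 4 (λ u v s t → u :- v := (u :+ t) :- (v :+ s) :+ s :- t) refl u v s t ⟩
    (u + t) - (v + s) + s - t ≡⟨ cong (λ w → w - (v + s) + s - t) (sym v+s≡u+t) ⟩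
    (v + s) - (v + s) + s - t ≡⟨ solve 3 (λ w s t → w :- w :+ s :- t := s :- t) refl (v + s) s t ⟩
    s - t                     ∎
    where open ≡-Reasoning

  ≤∧≢⇒< : ∀ {p q} → p ≤ q → p ≢ q → p < q
  ≤∧≢⇒< {p} {q} p≤q p≢q with ℚₚ.<-cmp p q
  ... | tri< p<q _ _ = p<q
  ... | tri≈ _ p≡q _ = contradiction p≡q p≢q
  ... | tri> _ _ q<p = contradiction (ℚₚ.<-≤-trans q<p p≤q) (ℚₚ.<-irrefl refl)

ℕtoℚ≡mkℚ : ∀ m → ℕtoℚ m ≡ ℚ.mkℚ (+ m) 0 (Coprime-sym (1-coprimeTo m))
ℕtoℚ≡mkℚ m = ℚₚ.normalize-coprime (Coprime-sym (1-coprimeTo m))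

ℕtoℚ-+ : ∀ m n → ℕtoℚ (m ℕ.+ n) ≡ ℕtoℚ m + ℕtoℚ n
ℕtoℚ-+ m n = begin
  (+ (m ℕ.+ n)) ℚ./ 1                 ≡⟨ cong₂ (λ a b → (a ℤ.+ b) ℚ./ 1) (sym (ℤₚ.*-identityʳ (+ m)))
                                                                         (sym (ℤₚ.*-identityʳ (+ n))) ⟩
  (+ m ℤ.* + 1 ℤ.+ + n ℤ.* + 1) ℚ./ 1 ≡⟨ cong₂ _+_ (ℕtoℚ≡mkℚ m) (ℕtoℚ≡mkℚ n) ⟨
  ℕtoℚ m + ℕtoℚ n                     ∎
  where open ≡-Reasoning

ℕtoℚ-mono-≤ : ∀ {m n} → m ℕ.≤ n → ℕtoℚ m ≤ ℕtoℚ n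
ℕtoℚ-mono-≤ {m} {n} m≤n rewrite ℕtoℚ≡mkℚ m | ℕtoℚ≡mkℚ n =
  ℚ.*≤* (subst₂ ℤ._≤_ (sym (ℤₚ.*-identityʳ (+ m))) (sym (ℤₚ.*-identityʳ (+ n))) (ℤ.+≤+ m≤n))

ℕtoℚ-cancel-≤ : ∀ {m n} → ℕtoℚ m ≤ ℕtoℚ n → m ℕ.≤ n
ℕtoℚ-cancel-≤ {m} {n} le rewrite ℕtoℚ≡mkℚ m | ℕtoℚ≡mkℚ n with ℚ.*≤* le′ ← le =
  ℤₚ.drop‿+≤+ (subst₂ ℤ._≤_ (ℤₚ.*-identityʳ (+ m)) (ℤₚ.*-identityʳ (+ n)) le′)

bounded-gap : ∀ {r X Y} → X ℕ.< Y → Y ℕ.≤ X ℕ.+ r → Σ (Fin r) λ k → suc (toℕ k) ℕ.+ X ≡ Y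
bounded-gap {r} {X} {Y} X<Y Y≤X+r =
  Fin.fromℕ< gap<r , trans (cong (λ t → suc t ℕ.+ X) (Finₚ.toℕ-fromℕ< gap<r)) gap+X
  where
  gap = Y ℕ.∸ suc X
  gap+X : suc gap ℕ.+ X ≡ Y
  gap+X = trans (sym (ℕₚ.+-suc gap X)) (ℕₚ.m∸n+n≡m X<Y)
  gap<r : gap ℕ.< r
  gap<r = ℕₚ.+-cancelʳ-≤ X (suc gap) r (subst₂ ℕ._≤_ (sym gap+X) (ℕₚ.+-comm X r) Y≤X+r)

count : ∀ {m} {P : Pred (Fin m) 0ℓ} → Decidable P → ℕ
count {zero}  P? = 0
count {suc m} P? with P? zero
... | yes _ = suc (count (P? ∘ suc))
... | no _  = count (P? ∘ suc)

count-mono : ∀ {m} {P Q : Pred (Fin m) 0ℓ} (P? : Decidable P) (Q? : Decidable Q) →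
             (∀ {i} → P i → Q i) → count P? ℕ.≤ count Q?
count-mono {zero}  P? Q? P⊆Q = z≤n
count-mono {suc m} P? Q? P⊆Q with P? zero | Q? zero
... | yes p | no ¬q = contradiction (P⊆Q p) ¬q
... | yes _ | yes _ = s≤s (count-mono (P? ∘ suc) (Q? ∘ suc) P⊆Q)
... | no _  | yes _ = ℕₚ.m≤n⇒m≤1+n (count-mono (P? ∘ suc) (Q? ∘ suc) P⊆Q)
... | no _  | no _  = count-mono (P? ∘ suc) (Q? ∘ suc) P⊆Q

count-strictMono : ∀ {m} {P Q : Pred (Fin m) 0ℓ} (P? : Decidable P) (Q? : Decidable Q) →
                   (∀ {i} → P i → Q i) → ∀ {i} → Q i → ¬ P i → count P? ℕ.< count Q?
count-strictMono {suc m} P? Q? P⊆Q {zero} q ¬p with P? zero | Q? zero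
... | yes p | _     = contradiction p ¬p
... | no _  | no ¬q = contradiction q ¬q
... | no _  | yes _ = s≤s (count-mono (P? ∘ suc) (Q? ∘ suc) P⊆Q)
count-strictMono {suc m} P? Q? P⊆Q {suc i} q ¬p with P? zero | Q? zero
... | yes p | no ¬q = contradiction (P⊆Q p) ¬q
... | yes _ | yes _ = s≤s (count-strictMono (P? ∘ suc) (Q? ∘ suc) P⊆Q q ¬p)
... | no _  | yes _ = ℕₚ.m<n⇒m<1+n (count-strictMono (P? ∘ suc) (Q? ∘ suc) P⊆Q q ¬p)
... | no _  | no _  = count-strictMono (P? ∘ suc) (Q? ∘ suc) P⊆Q q ¬p

count-U : ∀ m → count {m} (U? {A = Fin m}) ≡ m
count-U zero    = refl
count-U (suc m) = cong suc (count-U m)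

count<size : ∀ {m} {P : Pred (Fin m) 0ℓ} (P? : Decidable P) → ∀ {i} → ¬ P i → count P? ℕ.< m
count<size {m} P? ¬p = subst (count P? ℕ.<_) (count-U m) (count-strictMono P? U? (λ _ → tt) tt ¬p)

module _ {A : Set} (g : A → ℚ) where

  MinPositive : List A → Maybe A → Set
  MinPositive as nothing  = All (λ a → 0ℚ ≮ g a) as
  MinPositive as (just b) = 0ℚ < g b × All (λ a → 0ℚ < g a → g b ≤ g a) as

  minPos-minPositive : ∀ as → MinPositive as (minPos g as)
  minPos-minPositive [] = []
  minPos-minPositive (a ∷ as) with minPos g as | minPos-minPositive as
  ... | nothing | none with 0ℚ ℚₚ.<? g a
  ...   | yes 0<ga = 0<ga , (λ _ → ℚₚ.≤-refl) ∷ All.map (λ 0≮ 0< → contradiction 0< 0≮) none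
  ...   | no 0≮ga  = 0≮ga ∷ none
  minPos-minPositive (a ∷ as) | just b | 0<gb , min with 0ℚ ℚₚ.<? g a
  ...   | no 0≮ga  = 0<gb , (λ 0<ga → contradiction 0<ga 0≮ga) ∷ min
  ...   | yes 0<ga with g a ℚₚ.≤? g b
  ...     | yes ga≤gb = 0<ga , (λ _ → ℚₚ.≤-refl) ∷ All.map (λ gb≤ 0< → ℚₚ.≤-trans ga≤gb (gb≤ 0<)) min
  ...     | no ga≰gb  = 0<gb , (λ _ → ℚₚ.<⇒≤ (ℚₚ.≰⇒> ga≰gb)) ∷ min

module _ {A : Set} where

  lookup∈toList : ∀ {n} (v : Vec A n) i → lookup v i ∈ toList v
  lookup∈toList v i = ∈-toList⁺ (∈-lookup i v)

  ∈toList⇒lookup : ∀ {n} {u} (v : Vec A n) → u ∈ toList v → ∃ λ i → lookup v i ≡ u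
  ∈toList⇒lookup v u∈v = Anyᵥ.index u∈ᵥv , sym (lookup-index u∈ᵥv)
    where u∈ᵥv = ∈-toList⁻ u∈v

  lookup-injective : ∀ {n} (v : Vec A n) → Unique (toList v) → ∀ {i j} → lookup v i ≡ lookup v j → i ≡ j
  lookup-injective (a ∷ v) (_ ∷ _)     {zero}  {zero}  _  = refl
  lookup-injective (a ∷ v) (a∉v ∷ _)   {zero}  {suc j} eq = contradiction eq (All.lookup a∉v (lookup∈toList v j))
  lookup-injective (a ∷ v) (a∉v ∷ _)   {suc i} {zero}  eq = contradiction (sym eq) (All.lookup a∉v (lookup∈toList v i))
  lookup-injective (a ∷ v) (_ ∷ uniq)  {suc i} {suc j} eq = cong suc (lookup-injective v uniq eq)

  toList-tabulate : ∀ {n} (g : Fin n → A) → toList (Vec.tabulate g) ≡ List.tabulate g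
  toList-tabulate {zero}  g = refl
  toList-tabulate {suc n} g = cong (g zero ∷_) (toList-tabulate (g ∘ suc))

  ∈-removeAt⁻ : ∀ {n u} (v : Vec A (suc n)) q → u ∈ toList (removeAt v q) → u ∈ toList v
  ∈-removeAt⁻ (a ∷ v)           zero    u∈   = there u∈
  ∈-removeAt⁻ (a ∷ v@(_ ∷ _)) (suc q) (here u≡a) = here u≡a
  ∈-removeAt⁻ (a ∷ v@(_ ∷ _)) (suc q) (there u∈) = there (∈-removeAt⁻ v q u∈)

  ∈-removeAt⁺ : ∀ {n u} (v : Vec A (suc n)) q → u ∈ toList v → u ≢ lookup v q → u ∈ toList (removeAt v q)
  ∈-removeAt⁺ (a ∷ v)           zero    (here u≡a) u≢a = contradiction u≡a u≢a
  ∈-removeAt⁺ (a ∷ v)           zero    (there u∈) _   = u∈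
  ∈-removeAt⁺ (a ∷ v@(_ ∷ _)) (suc q) (here u≡a) _   = here u≡a
  ∈-removeAt⁺ (a ∷ v@(_ ∷ _)) (suc q) (there u∈) u≢  = there (∈-removeAt⁺ v q u∈ u≢)

  removeAt-unique : ∀ {n} (v : Vec A (suc n)) q → Unique (toList v) → Unique (toList (removeAt v q))
  removeAt-unique (a ∷ v)           zero    (_ ∷ uniq)   = uniq
  removeAt-unique (a ∷ v@(_ ∷ _)) (suc q) (a∉v ∷ uniq) =
    All.tabulate (All.lookup a∉v ∘ ∈-removeAt⁻ v q) ∷ removeAt-unique v q uniq

  lookup∉removeAt : ∀ {n} (v : Vec A (suc n)) q → Unique (toList v) → lookup v q ∉ toList (removeAt v q)
  lookup∉removeAt (a ∷ v)           zero    (a∉v ∷ _) a∈v         = All.lookup a∉v a∈v refl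
  lookup∉removeAt (a ∷ v@(_ ∷ _)) (suc q) (a∉v ∷ _) (here v[q]≡a) = All.lookup a∉v (lookup∈toList v q) (sym v[q]≡a)
  lookup∉removeAt (a ∷ v@(_ ∷ _)) (suc q) (_ ∷ uniq) (there v[q]∈) = lookup∉removeAt v q uniq v[q]∈

  ∈-∷ʳ⁻ : ∀ {n u a} (w : Vec A n) → u ∈ toList (w ∷ʳ a) → u ∈ toList w ⊎ u ≡ a
  ∈-∷ʳ⁻ {a = a} w u∈ with ∈-++⁻ (toList w) (subst (_ ∈_) (Vecₚ.toList-∷ʳ a w) u∈)
  ... | inj₁ u∈w        = inj₁ u∈w
  ... | inj₂ (here u≡a) = inj₂ u≡a

  ∈-∷ʳ⁺ˡ : ∀ {n u a} (w : Vec A n) → u ∈ toList w → u ∈ toList (w ∷ʳ a)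
  ∈-∷ʳ⁺ˡ {u = u} {a} w u∈w = subst (u ∈_) (sym (Vecₚ.toList-∷ʳ a w)) (∈-++⁺ˡ u∈w)

  ∈-∷ʳ⁺ʳ : ∀ {n a} (w : Vec A n) → a ∈ toList (w ∷ʳ a)
  ∈-∷ʳ⁺ʳ {a = a} w = subst (a ∈_) (sym (Vecₚ.toList-∷ʳ a w)) (∈-++⁺ʳ (toList w) (here refl))

  ∈-shiftIn⁻ : ∀ {r u a} (v : Vec A r) q → u ∈ toList (shiftIn r v q a) → u ≡ a ⊎ u ∈ toList v
  ∈-shiftIn⁻ {suc r} v q u∈ with ∈-∷ʳ⁻ (removeAt v q) u∈
  ... | inj₁ u∈v−q = inj₂ (∈-removeAt⁻ v q u∈v−q)
  ... | inj₂ u≡a   = inj₁ u≡a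

  ∈-shiftIn-new : ∀ {r a} (v : Vec A r) q → a ∈ toList (shiftIn r v q a)
  ∈-shiftIn-new {suc r} v q = ∈-∷ʳ⁺ʳ (removeAt v q)

  ∈-shiftIn⁺ : ∀ {r u a} (v : Vec A r) q → u ∈ toList v → u ≢ lookup v q → u ∈ toList (shiftIn r v q a)
  ∈-shiftIn⁺ {suc r} v q u∈v u≢v[q] = ∈-∷ʳ⁺ˡ (removeAt v q) (∈-removeAt⁺ v q u∈v u≢v[q])

  shiftIn-unique : ∀ {r a} (v : Vec A r) q → Unique (toList v) → a ∉ toList v → Unique (toList (shiftIn r v q a))
  shiftIn-unique {suc r} {a} v q uniq a∉v =
    subst Unique (sym (Vecₚ.toList-∷ʳ a (removeAt v q)))
      (Uniqueₚ.++⁺ (removeAt-unique v q uniq) ([] ∷ [])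
        (λ { (a∈v−q , here refl) → a∉v (∈-removeAt⁻ v q a∈v−q) }))

  lookup∈shiftIn : ∀ {r a} (v : Vec A r) q → Unique (toList v) →
                   lookup v q ∈ toList (shiftIn r v q a) → lookup v q ≡ a
  lookup∈shiftIn {suc r} v q uniq v[q]∈ with ∈-∷ʳ⁻ (removeAt v q) v[q]∈
  ... | inj₁ v[q]∈v−q = contradiction v[q]∈v−q (lookup∉removeAt v q uniq)
  ... | inj₂ v[q]≡a   = v[q]≡a

  ¬⊆⇒∃∉ : ∀ {xs ys : List A} → Decidable (_∈ ys) → ¬ (xs ⊆ ys) → ∃ λ z → z ∈ xs × z ∉ ys
  ¬⊆⇒∃∉ {xs} _∈ys? xs⊈ys with all? _∈ys? xs
  ... | yes xs⊆ys = contradiction (λ {z} → All.lookup xs⊆ys) xs⊈ys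
  ... | no  xs⊈ys′ = find (¬All⇒Any¬ _∈ys? xs xs⊈ys′)

  module _ (_≟_ : DecidableEquality A) where
    open import Data.List.Membership.DecPropositional _≟_ using (_∈?_)

    unique-⊆⇒⊇ : ∀ {r} (L M : Vec A r) → Unique (toList L) → toList L ⊆ toList M → toList M ⊆ toList L
    unique-⊆⇒⊇ {zero}  L [] uniq L⊆M ()
    unique-⊆⇒⊇ {suc r} L M  uniq L⊆M {c} c∈M with c ∈? toList L
    ... | yes c∈L = c∈L
    ... | no  c∉L = ⊥-elim (no-collision (Finₚ.pigeonhole (ℕₚ.n<1+n _) (λ i → punchOut (index≢c i))))
      where
      indexᴹ : ∀ {u} → u ∈ toList M → Fin (suc r)
      indexᴹ u∈M = proj₁ (∈toList⇒lookup M u∈M)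
      index-lookup : ∀ {u} (u∈M : u ∈ toList M) → lookup M (indexᴹ u∈M) ≡ u
      index-lookup u∈M = proj₂ (∈toList⇒lookup M u∈M)
      image : Fin (suc r) → Fin (suc r)
      image i = indexᴹ (L⊆M (lookup∈toList L i))
      index≢c : ∀ i → indexᴹ c∈M ≢ image i
      index≢c i eq = c∉L (subst (_∈ toList L)
        (trans (sym (index-lookup (L⊆M (lookup∈toList L i))))
               (trans (cong (lookup M) (sym eq)) (index-lookup c∈M)))
        (lookup∈toList L i))
      no-collision : ¬ ∃₂ λ i j → i Fin.< j × punchOut (index≢c i) ≡ punchOut (index≢c j)
      no-collision (i , j , i<j , eq) = Finₚ.<-irrefl (lookup-injective L uniq L[i]≡L[j]) i<j
        where L[i]≡L[j] = trans (sym (index-lookup (L⊆M (lookup∈toList L i))))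
                            (trans (cong (lookup M) (Finₚ.punchOut-injective (index≢c i) (index≢c j) eq))
                                   (index-lookup (L⊆M (lookup∈toList L j))))

-- Shifts and hyperplanes

-- The 1 added to c_{ijk} when i > j.
bump : ∀ {n} → Fin n → Fin n → ℕ
bump i j with toℕ j ℕ.<? toℕ i
... | yes _ = 1
... | no _  = 0

bump-< : ∀ {n} {i j : Fin n} → toℕ j ℕ.< toℕ i → bump i j ≡ 1
bump-< {i = i} {j} j<i with toℕ j ℕ.<? toℕ i
... | yes _   = refl
... | no j≮i = contradiction j<i j≮i

bump-≮ : ∀ {n} {i j : Fin n} → ¬ (toℕ j ℕ.< toℕ i) → bump i j ≡ 0
bump-≮ {i = i} {j} j≮i with toℕ j ℕ.<? toℕ i
... | yes j<i = contradiction j<i j≮i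
... | no _    = refl

bump≤1 : ∀ {n} {i j : Fin n} → bump i j ℕ.≤ 1
bump≤1 {i = i} {j} with toℕ j ℕ.<? toℕ i
... | yes _ = ℕₚ.≤-refl
... | no _  = z≤n

bump-sum : ∀ {n} {i j : Fin n} → i ≢ j → bump i j ℕ.+ bump j i ≡ 1
bump-sum {i = i} {j} i≢j with toℕ j ℕ.<? toℕ i | toℕ i ℕ.<? toℕ j
... | yes j<i | yes i<j = contradiction i<j (ℕₚ.<⇒≯ j<i)
... | yes _   | no _    = refl
... | no _    | yes _   = refl
... | no j≮i  | no i≮j  =
  contradiction (Finₚ.toℕ-injective (ℕₚ.≤-antisym (ℕₚ.≮⇒≥ j≮i) (ℕₚ.≮⇒≥ i≮j))) i≢j

bump-triangle : ∀ {n} {a b : Fin n} j → bump a j ℕ.+ bump b a ℕ.≤ suc (bump b j)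
bump-triangle {a = a} {b} j with toℕ a ℕ.<? toℕ b
... | no _ rewrite ℕₚ.+-identityʳ (bump a j) = ℕₚ.≤-trans bump≤1 (s≤s z≤n)
... | yes a<b with toℕ j ℕ.<? toℕ a
...   | yes j<a rewrite bump-< {i = b} {j = j} (ℕₚ.<-trans j<a a<b) = ℕₚ.≤-refl
...   | no _ = s≤s z≤n

-- For a ≢ b, x b + A = x a + B is a hyperplane of the r-Shi arrangement.
record Window {n} (r : ℕ) (a b : Fin n) (A B : ℕ) : Set where
  constructor window
  field
    below : B ℕ.+ bump b a ℕ.≤ A ℕ.+ r
    above : A ℕ.+ bump a b ℕ.≤ B ℕ.+ r

window-bound : ∀ {n r} {a b : Fin n} j (s t : Fin r) →
               (bump a j ℕ.+ suc (toℕ s)) ℕ.+ bump b a ℕ.≤ (bump b j ℕ.+ suc (toℕ t)) ℕ.+ r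
window-bound {r = r} {a} {b} j s t = begin
  (bump a j ℕ.+ suc (toℕ s)) ℕ.+ bump b a ≡⟨ solve 3 (λ α σ β → (α :+ σ) :+ β := σ :+ (α :+ β)) refl
                                                     (bump a j) (suc (toℕ s)) (bump b a) ⟩
  suc (toℕ s) ℕ.+ (bump a j ℕ.+ bump b a) ≤⟨ ℕₚ.+-mono-≤ (Finₚ.toℕ<n s) (bump-triangle j) ⟩
  r ℕ.+ suc (bump b j)                    ≤⟨ ℕₚ.+-monoʳ-≤ r (s≤s (ℕₚ.m≤m+n (bump b j) (toℕ t))) ⟩
  r ℕ.+ suc (bump b j ℕ.+ toℕ t)          ≡⟨ solve 3 (λ ρ γ τ → ρ :+ (con 1 :+ (γ :+ τ)) := (γ :+ (con 1 :+ τ)) :+ ρ) refl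
                                                     r (bump b j) (toℕ t) ⟩
  (bump b j ℕ.+ suc (toℕ t)) ℕ.+ r        ∎
  where open ℕₚ.≤-Reasoning
        open ℕ-Solver.+-*-Solver

window-parent : ∀ {n r} {i p : Fin n} j (k q : Fin r) →
                Window r i p (bump p j ℕ.+ suc (toℕ k)) (bump i j ℕ.+ suc (toℕ q))
window-parent j k q = window (window-bound j q k) (window-bound j k q)

posPart negPart : ℤ → ℕ
posPart (+ m)      = m
posPart -[1+ m ]   = 0
negPart (+ m)      = 0
negPart -[1+ m ]   = suc m

ℤtoℚ≡posPart-negPart : ∀ a → ℤtoℚ a ≡ ℕtoℚ (posPart a) - ℕtoℚ (negPart a)
ℤtoℚ≡posPart-negPart (+ m)    = sym (ℚₚ.+-identityʳ (ℕtoℚ m))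
ℤtoℚ≡posPart-negPart -[1+ m ] = sym (ℚₚ.+-identityˡ (- ℕtoℚ (suc m)))

window-hyperplane : ∀ {n r} {i j : Fin n} {a} → toℕ i ℕ.< toℕ j → IsShiHyperplane r a →
                    Window r j i (negPart a) (posPart a)
window-hyperplane {r = r} {i} {j} {+ m} i<j (-r<m , ℤ.+≤+ m≤r) = window below above
  where
  below : m ℕ.+ bump i j ℕ.≤ 0 ℕ.+ r
  below rewrite bump-≮ {i = i} {j = j} (ℕₚ.<⇒≯ i<j) | ℕₚ.+-identityʳ m = m≤r
  above : 0 ℕ.+ bump j i ℕ.≤ m ℕ.+ r
  above rewrite bump-< {i = j} {j = i} i<j = lower r -r<m
    where
    lower : ∀ r → ℤ.- (+ r) ℤ.< + m → 1 ℕ.≤ m ℕ.+ r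
    lower zero    (ℤ.+<+ 0<m) = ℕₚ.≤-trans 0<m (ℕₚ.m≤m+n m 0)
    lower (suc r) _          = ℕₚ.≤-trans (s≤s z≤n) (ℕₚ.m≤n+m (suc r) m)
window-hyperplane {r = suc r} {i} {j} { -[1+ m ]} i<j (ℤ.-<- m<r , _) = window below above
  where
  below : 0 ℕ.+ bump i j ℕ.≤ suc m ℕ.+ suc r
  below rewrite bump-≮ {i = i} {j = j} (ℕₚ.<⇒≯ i<j) = z≤n
  above : suc m ℕ.+ bump j i ℕ.≤ 0 ℕ.+ suc r
  above rewrite bump-< {i = j} {j = i} i<j | ℕₚ.+-comm (suc m) 1 = s≤s m<r

difference-hyperplane : ∀ {r} A B → B ℕ.< A ℕ.+ r → A ℕ.≤ B ℕ.+ r →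
                        ∃ λ m → IsShiHyperplane r m × ℤtoℚ m ≡ ℕtoℚ A - ℕtoℚ B
difference-hyperplane {r} A B B<A+r A≤B+r with ℕₚ.≤-<-connex B A
... | inj₁ B≤A with ℕₚ.m≤n⇒∃[o]m+o≡n B≤A
...   | D , refl = + D , (lower r 0<D+r , ℤ.+≤+ (ℕₚ.+-cancelˡ-≤ B D r A≤B+r)) , sym difference
  where
  0<D+r : 0 ℕ.< D ℕ.+ r
  0<D+r = ℕₚ.+-cancelˡ-< B 0 (D ℕ.+ r) (subst₂ ℕ._<_ (sym (ℕₚ.+-identityʳ B)) (ℕₚ.+-assoc B D r) B<A+r)
  lower : ∀ r → 0 ℕ.< D ℕ.+ r → ℤ.- (+ r) ℤ.< + D
  lower zero    0<D+0 = ℤ.+<+ (subst (0 ℕ.<_) (ℕₚ.+-identityʳ D) 0<D+0)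
  lower (suc r) _     = ℤ.-<+
  difference : ℕtoℚ (B ℕ.+ D) - ℕtoℚ B ≡ ℕtoℚ D
  difference = trans (cong (_- ℕtoℚ B) (ℕtoℚ-+ B D))
                      (solve 2 (λ b d → b :+ d :- b := d) refl (ℕtoℚ B) (ℕtoℚ D))
    where open +-*-Solver
difference-hyperplane {r} A B B<A+r A≤B+r | inj₂ A<B with ℕₚ.m≤n⇒∃[o]m+o≡n A<B
...   | E , refl = -[1+ E ] , (upper r 1+E<r , ℤ.-≤+) , sym difference
  where
  1+E<r : suc E ℕ.< r
  1+E<r = ℕₚ.+-cancelˡ-< A (suc E) r (subst (ℕ._< A ℕ.+ r) (sym (ℕₚ.+-suc A E)) B<A+r)
  upper : ∀ r → suc E ℕ.< r → ℤ.- (+ r) ℤ.< -[1+ E ]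
  upper (suc r) (s≤s E<r) = ℤ.-<- E<r
  difference : ℕtoℚ A - ℕtoℚ (suc A ℕ.+ E) ≡ - ℕtoℚ (suc E)
  difference = trans (cong (λ t → ℕtoℚ A - ℕtoℚ t) (sym (ℕₚ.+-suc A E)))
    (trans (cong (λ t → ℕtoℚ A - t) (ℕtoℚ-+ A (suc E)))
           (solve 2 (λ a e → a :- (a :+ e) := :- e) refl (ℕtoℚ A) (ℕtoℚ (suc E))))
    where open +-*-Solver

-- The tree of a single point

vertex-≟ : ∀ {r n} → DecidableEquality (Vertex r n)
vertex-≟ = ≡-dec Finₚ._≟_ Finₚ._≟_

module Tree (r : ℕ) {n : ℕ} (x : Point n) where

  infix 7 _⊕_
  _⊕_ : Fin n → ℕ → ℚ
  i ⊕ A = x i + ℕtoℚ A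

  ⊕-+ : ∀ i A B → i ⊕ A + ℕtoℚ B ≡ i ⊕ (A ℕ.+ B)
  ⊕-+ i A B = trans (ℚₚ.+-assoc (x i) _ _) (cong (λ t → x i + t) (sym (ℕtoℚ-+ A B)))

  ⊕-rescale : ∀ {a b} A B A′ B′ → A ℕ.+ B′ ≡ A′ ℕ.+ B → b ⊕ A < a ⊕ B → b ⊕ A′ < a ⊕ B′
  ⊕-rescale {a} {b} A B A′ B′ A+B′≡A′+B A<B =
    +-cancelʳ-< (ℕtoℚ B) (subst₂ _<_ left right (ℚₚ.+-monoˡ-< (ℕtoℚ B′) A<B))
    where
    left : b ⊕ A + ℕtoℚ B′ ≡ b ⊕ A′ + ℕtoℚ B
    left = trans (⊕-+ b A B′) (trans (cong (b ⊕_) A+B′≡A′+B) (sym (⊕-+ b A′ B)))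
    right : a ⊕ B + ℕtoℚ B′ ≡ a ⊕ B′ + ℕtoℚ B
    right = trans (⊕-+ a B B′) (trans (cong (a ⊕_) (ℕₚ.+-comm B B′)) (sym (⊕-+ a B′ B)))

  ⊕-≤⇔ : ∀ {i A B} → i ⊕ A ≤ i ⊕ B ⇔ A ℕ.≤ B
  ⊕-≤⇔ {i} = mk⇔
    (λ le → ℕtoℚ-cancel-≤ (+-cancelʳ-≤ (x i) (subst₂ _≤_ (ℚₚ.+-comm (x i) _) (ℚₚ.+-comm (x i) _) le)))
    (λ A≤B → ℚₚ.+-monoʳ-≤ (x i) (ℕtoℚ-mono-≤ A≤B))

  c-form : ∀ {i j k} → i ≢ j → c r n x i j k ≡ i ⊕ bump i j - j ⊕ suc (toℕ k)
  c-form {i} {j} {k} i≢j with toℕ i ℕ.<? toℕ j | toℕ j ℕ.<? toℕ i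
  ... | yes i<j | yes j<i = contradiction i<j (ℕₚ.<⇒≯ j<i)
  ... | yes _   | no _    =
    solve 3 (λ a b s → a :- b :- s := (a :+ con 0ℚ) :- (b :+ s)) refl (x i) (x j) (ℕtoℚ (suc (toℕ k)))
    where open +-*-Solver
  ... | no _    | yes _   =
    solve 4 (λ a b s o → a :- b :- s :+ o := (a :+ o) :- (b :+ s)) refl (x i) (x j) (ℕtoℚ (suc (toℕ k))) (ℕtoℚ 1)
    where open +-*-Solver
  ... | no i≮j  | no j≮i  =
    contradiction (Finₚ.toℕ-injective (ℕₚ.≤-antisym (ℕₚ.≮⇒≥ j≮i) (ℕₚ.≮⇒≥ i≮j))) i≢j

  c-pos⇔ : ∀ {i j k} → i ≢ j → 0ℚ < c r n x i j k ⇔ j ⊕ suc (toℕ k) < i ⊕ bump i j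
  c-pos⇔ {i} {j} {k} i≢j = begin
    0ℚ < c r n x i j k                  ≡⟨ cong (0ℚ <_) (c-form i≢j) ⟩
    0ℚ < i ⊕ bump i j - j ⊕ suc (toℕ k) ≈⟨ 0<p-q⇔q<p (i ⊕ bump i j) (j ⊕ suc (toℕ k)) ⟩
    j ⊕ suc (toℕ k) < i ⊕ bump i j      ∎
    where open ⇔-Reasoning

  c-pos⇔⊕ : ∀ {i j k} A B → i ≢ j → suc (toℕ k) ℕ.+ B ≡ A ℕ.+ bump i j →
            0ℚ < c r n x i j k ⇔ j ⊕ A < i ⊕ B
  c-pos⇔⊕ {i} {j} {k} A B i≢j e = begin
    0ℚ < c r n x i j k             ≈⟨ c-pos⇔ i≢j ⟩
    j ⊕ suc (toℕ k) < i ⊕ bump i j ≈⟨ mk⇔ (⊕-rescale (suc (toℕ k)) (bump i j) A B e)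
                                          (⊕-rescale A B (suc (toℕ k)) (bump i j) (sym e)) ⟩
    j ⊕ A < i ⊕ B                  ∎
    where open ⇔-Reasoning

  c-≤⇔ : ∀ {i i′ j k k′} → i ≢ j → i′ ≢ j →
         c r n x i j k ≤ c r n x i′ j k′ ⇔ i ⊕ (bump i j ℕ.+ suc (toℕ k′)) ≤ i′ ⊕ (bump i′ j ℕ.+ suc (toℕ k))
  c-≤⇔ {i} {i′} {j} {k} {k′} i≢j i′≢j = begin
    c r n x i j k ≤ c r n x i′ j k′
      ≡⟨ cong₂ _≤_ (c-form i≢j) (c-form i′≢j) ⟩
    i ⊕ bump i j - j ⊕ suc (toℕ k) ≤ i′ ⊕ bump i′ j - j ⊕ suc (toℕ k′)
      ≈⟨ p-q≤p′-q′⇔p+q′≤p′+q (i ⊕ bump i j) (j ⊕ suc (toℕ k)) (i′ ⊕ bump i′ j) (j ⊕ suc (toℕ k′)) ⟩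
    i ⊕ bump i j + j ⊕ suc (toℕ k′) ≤ i′ ⊕ bump i′ j + j ⊕ suc (toℕ k)
      ≡⟨ cong₂ _≤_ (interchange i k′) (interchange i′ k) ⟩
    i ⊕ (bump i j ℕ.+ suc (toℕ k′)) + x j ≤ i′ ⊕ (bump i′ j ℕ.+ suc (toℕ k)) + x j
      ≈⟨ ≤-+ʳ (x j) ⟨
    i ⊕ (bump i j ℕ.+ suc (toℕ k′)) ≤ i′ ⊕ (bump i′ j ℕ.+ suc (toℕ k))
      ∎
    where
    open ⇔-Reasoning
    interchange : ∀ a (s : Fin r) → a ⊕ bump a j + j ⊕ suc (toℕ s) ≡ a ⊕ (bump a j ℕ.+ suc (toℕ s)) + x j
    interchange a s = trans (solve 4 (λ u v b t → (u :+ b) :+ (v :+ t) := (u :+ b :+ t) :+ v) refl (x a) (x j) _ _)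
                            (cong (_+ x j) (⊕-+ a (bump a j) (suc (toℕ s))))
      where open +-*-Solver

  parent : Fin n → Maybe (Fin n × Fin r)
  parent = minimalPositive r n x

  private
    column : Fin n → Fin n × Fin r → ℚ
    column j pk = c r n x (proj₁ pk) j (proj₂ pk)

    indices : List (Fin n × Fin r)
    indices = cartesianProduct (allFin n) (allFin r)

    ∈-indices : ∀ i k → (i , k) ∈ indices
    ∈-indices i k = ∈-cartesianProduct⁺ (∈-allFin i) (∈-allFin k)

    parent-minPositive : ∀ {j m} → parent j ≡ m → MinPositive (column j) indices m
    parent-minPositive {j} refl = minPos-minPositive (column j) indices

  parent-root : ∀ j → parent j ≡ nothing → ∀ i k → 0ℚ ≮ c r n x i j k
  parent-root j eq i k = All.lookup (parent-minPositive {j} eq) (∈-indices i k)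

  parent-pos : ∀ {p q} j → parent j ≡ just (p , q) → 0ℚ < c r n x p j q
  parent-pos j eq = proj₁ (parent-minPositive {j} eq)

  parent-min : ∀ {p q} j → parent j ≡ just (p , q) →
               ∀ {i k} → 0ℚ < c r n x i j k → c r n x p j q ≤ c r n x i j k
  parent-min j eq {i} {k} = All.lookup (proj₂ (parent-minPositive {j} eq)) (∈-indices i k)

  c-diagonal : ∀ j k → c r n x j j k ≡ 0ℚ
  c-diagonal j k with toℕ j ℕ.<? toℕ j
  ... | yes j<j = contradiction j<j (ℕₚ.<-irrefl refl)
  ... | no _    = refl

  parent-≢ : ∀ {p q} j → parent j ≡ just (p , q) → p ≢ j
  parent-≢ {q = q} j eq refl = ℚₚ.<-irrefl (sym (c-diagonal j q)) (parent-pos j eq)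

  parent-above : ∀ {p q} j → parent j ≡ just (p , q) → x j < x p
  parent-above {p} {q} j eq = +-cancelʳ-< (ℕtoℚ (bump p j))
    (ℚₚ.≤-<-trans (ℚₚ.+-monoʳ-≤ (x j) (ℕtoℚ-mono-≤ {bump p j} {suc (toℕ q)} (ℕₚ.≤-trans bump≤1 (s≤s z≤n))))
                  (Equivalence.to (c-pos⇔ {p} {j} {q} (parent-≢ j eq)) (parent-pos j eq)))

  rank : Fin n → ℕ
  rank j = count (λ i → x j ℚₚ.<? x i)

  rank-< : ∀ {j p} → x j < x p → rank p ℕ.< rank j
  rank-< {j} {p} xj<xp =
    count-strictMono (λ i → x p ℚₚ.<? x i) (λ i → x j ℚₚ.<? x i) (ℚₚ.<-trans xj<xp) xj<xp (ℚₚ.<-irrefl refl)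

  rank<n : ∀ j → rank j ℕ.< n
  rank<n j = count<size (λ i → x j ℚₚ.<? x i) (ℚₚ.<-irrefl refl)

  _⊐_ : Fin n → Fin n → Set
  p ⊐ j = x j < x p

  ⊐-wellFounded : WellFounded _⊐_
  ⊐-wellFounded = Subrelation.wellFounded rank-< (On.wellFounded rank <-wellFounded)

  fFuel-stable : ∀ k j → rank j ℕ.< k → fFuel r n x k j ≡ fFuel r n x (suc k) j
  fFuel-stable (suc k) j rank<1+k with minimalPositive r n x j in eq
  ... | nothing      = refl
  ... | just (p , q) = cong (λ v → shiftIn r v q (inj₂ p))
                            (fFuel-stable k p (ℕₚ.<-≤-trans (rank-< (parent-above j eq)) (ℕₚ.≤-pred rank<1+k)))

  f-root : ∀ j → parent j ≡ nothing → f r n x j ≡ os r n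
  f-root j eq = unfold n (rank<n j)
    where
    unfold : ∀ k → rank j ℕ.< k → fFuel r n x k j ≡ os r n
    unfold (suc k) _ rewrite eq = refl

  f-child : ∀ {p q} j → parent j ≡ just (p , q) → f r n x j ≡ shiftIn r (f r n x p) q (inj₂ p)
  f-child {p} {q} j eq = unfold n (rank<n j)
    where
    unfold : ∀ k → rank j ℕ.< k → fFuel r n x k j ≡ shiftIn r (fFuel r n x k p) q (inj₂ p)
    unfold (suc k) rank<1+k rewrite eq = cong (λ v → shiftIn r v q (inj₂ p))
      (fFuel-stable k p (ℕₚ.<-≤-trans (rank-< (parent-above j eq)) (ℕₚ.≤-pred rank<1+k)))

  infix 4 _∈F_ _∉F_
  _∈F_ _∉F_ : Vertex r n → Fin n → Set
  u ∈F j = u ∈ toList (f r n x j)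
  u ∉F j = ¬ (u ∈F j)

  _∈F?_ : ∀ u j → Dec (u ∈F j)
  u ∈F? j = DecMembership._∈?_ vertex-≟ u (toList (f r n x j))

  infix 4 _≺_
  _≺_ : Fin n → Vertex r n → Set
  j ≺ inj₁ _ = ⊤
  j ≺ inj₂ i = x j < x i

  ≺-trans : ∀ {a b} u → x a < x b → b ≺ u → a ≺ u
  ≺-trans (inj₁ _) _    _    = tt
  ≺-trans (inj₂ _) a<b b<u = ℚₚ.<-trans a<b b<u

  v∉F-root : ∀ j → parent j ≡ nothing → ∀ {i} → inj₂ i ∉F j
  v∉F-root j eq {i} i∈ with ∈toList⇒lookup (os r n) (subst (λ v → inj₂ i ∈ toList v) (f-root j eq) i∈)
  ... | t , os[t]≡i with () ← trans (sym (Vecₚ.lookup∘tabulate inj₁ t)) os[t]≡i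

  ∈F-child⁻ : ∀ {p q u} j → parent j ≡ just (p , q) → u ∈F j → Clique r n x p u
  ∈F-child⁻ {p} {q} {u} j eq u∈ = ∈-shiftIn⁻ (f r n x p) q (subst (λ v → u ∈ toList v) (f-child j eq) u∈)

  parent∈F : ∀ {p q} j → parent j ≡ just (p , q) → inj₂ p ∈F j
  parent∈F {p} {q} j eq = subst (λ v → inj₂ p ∈ toList v) (sym (f-child j eq)) (∈-shiftIn-new (f r n x p) q)

  ∈F-child⁺ : ∀ {p q u} j → parent j ≡ just (p , q) → u ∈F p → u ≢ lookup (f r n x p) q → u ∈F j
  ∈F-child⁺ {p} {q} {u} j eq u∈p u≢ =
    subst (λ v → u ∈ toList v) (sym (f-child j eq)) (∈-shiftIn⁺ (f r n x p) q u∈p u≢)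

  F-above : ∀ {j u} → u ∈F j → j ≺ u
  F-above = go (⊐-wellFounded _)
    where
    go : ∀ {j u} → Acc _⊐_ j → u ∈F j → j ≺ u
    go {j} {inj₁ _} _ _ = tt
    go {j} {inj₂ i} (acc rec) i∈ with parent j in eq
    ... | nothing      = contradiction i∈ (v∉F-root j eq)
    ... | just (p , q) with ∈F-child⁻ j eq i∈
    ...   | inj₁ refl = parent-above j eq
    ...   | inj₂ i∈p  = ℚₚ.<-trans (parent-above j eq) (go (rec (parent-above j eq)) i∈p)

  j∉F-j : ∀ {j} → inj₂ j ∉F j
  j∉F-j j∈ = ℚₚ.<-irrefl refl (F-above j∈)

  F-unique : ∀ j → Unique (toList (f r n x j))
  F-unique j = go (⊐-wellFounded j)
    where
    go : ∀ {j} → Acc _⊐_ j → Unique (toList (f r n x j))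
    go {j} (acc rec) with parent j in eq
    ... | nothing      = subst (Unique ∘ toList) (sym (f-root j eq))
                           (subst Unique (sym (toList-tabulate inj₁)) (Uniqueₚ.tabulate⁺ inj₁-injective))
    ... | just (p , q) = subst (Unique ∘ toList) (sym (f-child j eq))
                           (shiftIn-unique (f r n x p) q (go (rec (parent-above j eq))) j∉F-j)

  removed∉F : ∀ {p q} j → parent j ≡ just (p , q) → lookup (f r n x p) q ∉F j
  removed∉F {p} {q} j eq removed∈ = j∉F-j (subst (_∈F p) removed≡p (lookup∈toList (f r n x p) q))
    where
    removed≡p : lookup (f r n x p) q ≡ inj₂ p
    removed≡p = lookup∈shiftIn (f r n x p) q (F-unique p) (subst (λ v → _ ∈ toList v) (f-child j eq) removed∈)

  clique-comparable : ∀ {l a u} → Clique r n x l (inj₂ a) → Clique r n x l u → inj₂ a ≢ u →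
                      u ∈F a ⊎ ∃ λ b → u ≡ inj₂ b × inj₂ a ∈F b
  clique-comparable = go (⊐-wellFounded _)
    where
    go : ∀ {l a u} → Acc _⊐_ l → Clique r n x l (inj₂ a) → Clique r n x l u → inj₂ a ≢ u →
         u ∈F a ⊎ ∃ λ b → u ≡ inj₂ b × inj₂ a ∈F b
    go _ (inj₁ refl) (inj₁ refl) a≢u = contradiction refl a≢u
    go _ (inj₁ refl) (inj₂ u∈l)  _   = inj₁ u∈l
    go _ (inj₂ a∈l)  (inj₁ refl) _   = inj₂ (_ , refl , a∈l)
    go {l} (acc rec) (inj₂ a∈l) (inj₂ u∈l) a≢u with parent l in eq
    ... | nothing      = contradiction a∈l (v∉F-root l eq)
    ... | just (p , q) = go (rec (parent-above l eq)) (∈F-child⁻ l eq a∈l) (∈F-child⁻ l eq u∈l) a≢u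

  clique-above : ∀ {l a u} → Clique r n x l (inj₂ a) → Clique r n x l u → a ≺ u → u ∈F a
  clique-above a∈l u∈l a≺u with clique-comparable a∈l u∈l (λ { refl → ℚₚ.<-irrefl refl a≺u })
  ... | inj₁ u∈a               = u∈a
  ... | inj₂ (_ , refl , a∈b) = contradiction a≺u (ℚₚ.<-asym (F-above a∈b))

  ∈F⇒edge : ∀ {j u} → u ∈F j → Edge r n x (inj₂ j) u
  ∈F⇒edge u∈j = (λ { refl → j∉F-j u∈j }) , _ , inj₁ refl , inj₂ u∈j

  edge-comparable : ∀ {a u} → Edge r n x (inj₂ a) u → u ∈F a ⊎ ∃ λ b → u ≡ inj₂ b × inj₂ a ∈F b
  edge-comparable (a≢u , _ , a∈l , u∈l) = clique-comparable a∈l u∈l a≢u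

  edge-above⇒∈F : ∀ {a u} → Edge r n x (inj₂ a) u → a ≺ u → u ∈F a
  edge-above⇒∈F (_ , _ , a∈l , u∈l) = clique-above a∈l u∈l

  infix 4 _⟶_ _⟶*_
  _⟶_ _⟶*_ : Fin n → Fin n → Set
  j ⟶ p = ∃ λ q → parent j ≡ just (p , q)
  _⟶*_ = Star _⟶_

  ∈F-descendant : ∀ {w b u} → w ⟶* b → u ∈F w → u ∈F b ⊎ ∃ λ u′ → u ≡ inj₂ u′ × u′ ⟶* b
  ∈F-descendant ε u∈w = inj₁ u∈w
  ∈F-descendant {w} ((_ , eq) ◅ p⟶*b) u∈w with ∈F-child⁻ w eq u∈w
  ... | inj₁ refl = inj₂ (_ , refl , p⟶*b)
  ... | inj₂ u∈p  = ∈F-descendant p⟶*b u∈p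

  ∈F⇒ancestor : ∀ {w u} → inj₂ w ∈F u → u ⟶* w
  ∈F⇒ancestor = go (⊐-wellFounded _)
    where
    go : ∀ {w u} → Acc _⊐_ u → inj₂ w ∈F u → u ⟶* w
    go {u = u} (acc rec) w∈u with parent u in eq
    ... | nothing      = contradiction w∈u (v∉F-root u eq)
    ... | just (p , q) with ∈F-child⁻ u eq w∈u
    ...   | inj₁ refl = (q , eq) ◅ ε
    ...   | inj₂ w∈p  = (q , eq) ◅ go (rec (parent-above u eq)) w∈p

  Descendant : Fin n → Vertex r n → Set
  Descendant b (inj₁ _) = ⊥
  Descendant b (inj₂ w) = w ⟶* b

  Avoiding : Pred (Vertex r n) 0ℓ → Rel (Vertex r n) 0ℓ
  Avoiding S = Star (λ u w → Edge r n x u w × ¬ S w)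

  descendant-closed : ∀ {b u t} → Descendant b u → Avoiding (_∈F b) u t → Descendant b t
  descendant-closed d ε = d
  descendant-closed {u = inj₂ w} w⟶*b ((w—v , v∉b) ◅ path) with edge-comparable w—v
  ... | inj₂ (_ , refl , w∈u′) = descendant-closed (∈F⇒ancestor w∈u′ ◅◅ w⟶*b) path
  ... | inj₁ v∈w with ∈F-descendant w⟶*b v∈w
  ...   | inj₁ v∈b               = contradiction v∈b v∉b
  ...   | inj₂ (_ , refl , u′⟶*b) = descendant-closed u′⟶*b path

  F-separates : ∀ {b t} → ¬ Avoiding (_∈F b) (inj₂ b) (inj₁ t)
  F-separates = descendant-closed ε

  escape : ∀ (S : Pred (Vertex r n) 0ℓ) {b u} → (∀ {s} → S s → b ≺ s → s ∈F b) → u ∈F b → ¬ S u →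
           ∃ λ t → Avoiding S (inj₂ b) (inj₁ t)
  escape S = go (⊐-wellFounded _)
    where
    go : ∀ {b u} → Acc _⊐_ b → (∀ {s} → S s → b ≺ s → s ∈F b) → u ∈F b → ¬ S u →
         ∃ λ t → Avoiding S (inj₂ b) (inj₁ t)
    go {u = inj₁ t} _ _ t∈b ¬St = t , (∈F⇒edge t∈b , ¬St) ◅ ε
    go {b} {inj₂ c} (acc rec) S↑b⊆F c∈b ¬Sc with ¬⊆⇒∃∉ (_∈F? b) F[c]⊈F[b]
      where
      F[c]⊈F[b] : ¬ (toList (f r n x c) ⊆ toList (f r n x b))
      F[c]⊈F[b] F[c]⊆F[b] = j∉F-j (unique-⊆⇒⊇ vertex-≟ (f r n x c) (f r n x b) (F-unique c) F[c]⊆F[b] c∈b)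
    ... | z , z∈c , z∉b = Product.map₂ ((∈F⇒edge c∈b , ¬Sc) ◅_) (go (rec (F-above c∈b)) S↑c⊆F z∈c ¬Sz)
      where
      S↑c⊆F : ∀ {s} → S s → c ≺ s → s ∈F c
      S↑c⊆F {s} Ss c≺s = clique-above (inj₂ c∈b) (inj₂ (S↑b⊆F Ss (≺-trans s (F-above c∈b) c≺s))) c≺s
      ¬Sz : ¬ S z
      ¬Sz Sz = z∉b (S↑b⊆F Sz (≺-trans z (F-above c∈b) (F-above z∈c)))

  c-parent⇔ : ∀ {p q k} j → parent j ≡ just (p , q) → 0ℚ < c r n x p j k ⇔ toℕ k ℕ.≤ toℕ q
  c-parent⇔ {p} {q} {k} j eq = mk⇔
    (λ pos → ℕₚ.≤-pred (ℕₚ.+-cancelˡ-≤ (bump p j) _ _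
               (Equivalence.to ⊕-≤⇔ (Equivalence.to (c-≤⇔ p≢j p≢j) (parent-min j eq pos)))))
    (λ k≤q → ℚₚ.<-≤-trans (parent-pos j eq)
               (Equivalence.from (c-≤⇔ p≢j p≢j) (Equivalence.from ⊕-≤⇔ (ℕₚ.+-monoʳ-≤ (bump p j) (s≤s k≤q)))))
    where p≢j = parent-≢ j eq

  hyperplane-side⇔ : ∀ i j a → x i - x j < ℤtoℚ a ⇔ i ⊕ negPart a < j ⊕ posPart a
  hyperplane-side⇔ i j a = begin
    x i - x j < ℤtoℚ a
      ≡⟨ cong (x i - x j <_) (ℤtoℚ≡posPart-negPart a) ⟩
    x i - x j < ℕtoℚ (posPart a) - ℕtoℚ (negPart a)
      ≈⟨ p-q<s-t⇔p+t<q+s (x i) (x j) (ℕtoℚ (posPart a)) (ℕtoℚ (negPart a)) ⟩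
    i ⊕ negPart a < j ⊕ posPart a
      ∎
    where open ⇔-Reasoning

  module Generic (generic : InComplement r n x) where

    ⊕-≢ : ∀ {a b A B} → a ≢ b → Window r a b A B → b ⊕ A ≢ a ⊕ B
    ⊕-≢ {a} {b} {A} {B} a≢b (window win₁ win₂) eq with ℕₚ.<-cmp (toℕ a) (toℕ b)
    ... | tri< a<b _ _ rewrite bump-< {i = b} {j = a} a<b | bump-≮ {i = a} {j = b} (ℕₚ.<⇒≯ a<b) =
      let m , shi , m≡A-B = difference-hyperplane A B (subst (ℕ._≤ A ℕ.+ r) (ℕₚ.+-comm B 1) win₁)
                                                      (subst (ℕ._≤ B ℕ.+ r) (ℕₚ.+-identityʳ A) win₂)
      in generic a b a<b m shi (trans (v+s≡u+t⇒u-v≡s-t (x a) (x b) _ _ eq) (sym m≡A-B))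
    ... | tri> _ _ b<a rewrite bump-≮ {i = b} {j = a} (ℕₚ.<⇒≯ b<a) | bump-< {i = a} {j = b} b<a =
      let m , shi , m≡B-A = difference-hyperplane B A (subst (ℕ._≤ B ℕ.+ r) (ℕₚ.+-comm A 1) win₂)
                                                      (subst (ℕ._≤ A ℕ.+ r) (ℕₚ.+-identityʳ B) win₁)
      in generic b a b<a m shi (trans (v+s≡u+t⇒u-v≡s-t (x b) (x a) _ _ (sym eq)) (sym m≡B-A))
    ... | tri≈ _ a≡b _ = contradiction (Finₚ.toℕ-injective a≡b) a≢b

    c-via-parent⇔ : ∀ {i p q k} j → parent j ≡ just (p , q) → i ≢ p → i ≢ j →
                    0ℚ < c r n x i j k ⇔ p ⊕ (bump p j ℕ.+ suc (toℕ k)) < i ⊕ (bump i j ℕ.+ suc (toℕ q))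
    c-via-parent⇔ {i} {p} {q} {k} j eq i≢p i≢j = mk⇔
      (λ pos → ≤∧≢⇒< (Equivalence.to (c-≤⇔ p≢j i≢j) (parent-min j eq pos)) (⊕-≢ i≢p (window-parent j k q)))
      (λ lt → ℚₚ.<-≤-trans (parent-pos j eq) (Equivalence.from (c-≤⇔ p≢j i≢j) (ℚₚ.<⇒≤ lt)))
      where p≢j = parent-≢ j eq

-- Two points with the same tree

module _ (r : ℕ) {n : ℕ} (x y : Point n) where

  private
    module X = Tree r x
    module Y = Tree r y

  Agree : Fin n → Fin n → Set
  Agree i j = ∀ k → 0ℚ < c r n x i j k ⇔ 0ℚ < c r n y i j k

  -- Depending on whether B < A + bump a b, the comparison b ⊕ A < a ⊕ B is the sign of some c_{abk}
  -- or, by genericity, the negated sign of some c_{bak}.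
  ⊕-transfer : InComplement r n y → ∀ {a b A B} → a ≢ b → Agree a b → Agree b a → Window r a b A B →
               b X.⊕ A < a X.⊕ B → b Y.⊕ A < a Y.⊕ B
  ⊕-transfer generic {a} {b} {A} {B} a≢b agree-ab agree-ba win@(window below above) xb+A<xa+B
    with ℕₚ.<-≤-connex B (A ℕ.+ bump a b)
  ... | inj₁ B<A+δ =
    let k , e = bounded-gap B<A+δ above
    in Equivalence.to (Y.c-pos⇔⊕ A B a≢b e)
         (Equivalence.to (agree-ab k) (Equivalence.from (X.c-pos⇔⊕ A B a≢b e) xb+A<xa+B))
  ... | inj₂ A+δ≤B with b Y.⊕ A ℚₚ.<? a Y.⊕ B
  ...   | yes yb+A<ya+B = yb+A<ya+B
  ...   | no  yb+A≮ya+B = contradiction xb+A<xa+B (ℚₚ.<-asym xa+B<xb+A)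
    where
    A<B+δ : A ℕ.< B ℕ.+ bump b a
    A<B+δ = begin
      suc A                               ≡⟨ ℕₚ.+-comm 1 A ⟩
      A ℕ.+ 1                             ≡⟨ cong (A ℕ.+_) (bump-sum a≢b) ⟨
      A ℕ.+ (bump a b ℕ.+ bump b a)       ≡⟨ ℕₚ.+-assoc A _ _ ⟨
      A ℕ.+ bump a b ℕ.+ bump b a         ≤⟨ ℕₚ.+-monoˡ-≤ (bump b a) A+δ≤B ⟩
      B ℕ.+ bump b a                      ∎
      where open ℕₚ.≤-Reasoning
    k = proj₁ (bounded-gap A<B+δ below)
    e = proj₂ (bounded-gap A<B+δ below)
    ya+B<yb+A : a Y.⊕ B < b Y.⊕ A
    ya+B<yb+A = ≤∧≢⇒< (ℚₚ.≮⇒≥ yb+A≮ya+B) (≢-sym (Y.Generic.⊕-≢ generic a≢b win))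
    xa+B<xb+A : a X.⊕ B < b X.⊕ A
    xa+B<xb+A = Equivalence.to (X.c-pos⇔⊕ B A (≢-sym a≢b) e)
                  (Equivalence.from (agree-ba k) (Equivalence.from (Y.c-pos⇔⊕ B A (≢-sym a≢b) e) ya+B<yb+A))

sameGraph-sym : ∀ {r n} {x y : Point n} → SameGraph r n x y → SameGraph r n y x
sameGraph-sym same u w = ⇔.sym (same u w)

module _ {r n : ℕ} {x y : Point n} (same : SameGraph r n x y) where

  private
    module X = Tree r x
    module Y = Tree r y

  -- Otherwise escape leads in T_x = T_y from v_b to O avoiding F_y(v_b), which F-separates forbids.
  F-⊆ : ∀ {b u} → u X.∈F b → u Y.∈F b
  F-⊆ {b} {u} u∈x with u Y.∈F? b
  ... | yes u∈y = u∈y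
  ... | no  u∉y = ⊥-elim (Y.F-separates (Star.map (Product.map₁ (Equivalence.to (same _ _)))
                                                   (proj₂ escaping)))
    where
    Y-neighbours-above : ∀ {s} → s Y.∈F b → b X.≺ s → s X.∈F b
    Y-neighbours-above s∈y b≺s = X.edge-above⇒∈F (Equivalence.from (same _ _) (Y.∈F⇒edge s∈y)) b≺s
    escaping = X.escape (Y._∈F b) Y-neighbours-above u∈x u∉y

module _ {r n : ℕ} {x y : Point n} (same : SameGraph r n x y) where

  private
    module X = Tree r x
    module Y = Tree r y

  same-parent : ∀ {p q p′ q′} b → X.parent b ≡ just (p , q) → Y.parent b ≡ just (p′ , q′) → p ≡ p′
  same-parent {p} {q} {p′} {q′} b ex ey with p Finₚ.≟ p′
  ... | yes p≡p′ = p≡p′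
  ... | no  p≢p′ = contradiction yp<yp′ (ℚₚ.<-asym yp′<yp)
    where
    yp<yp′ : y p < y p′
    yp<yp′ with X.∈F-child⁻ b ex (F-⊆ (sameGraph-sym same) (Y.parent∈F b ey))
    ... | inj₁ p′≡p  = contradiction (sym (inj₂-injective p′≡p)) p≢p′
    ... | inj₂ p′∈xp = Y.F-above (F-⊆ same p′∈xp)
    yp′<yp : y p′ < y p
    yp′<yp with Y.∈F-child⁻ b ey (F-⊆ same (X.parent∈F b ex))
    ... | inj₁ p≡p′ = contradiction (inj₂-injective p≡p′) p≢p′
    ... | inj₂ p∈yp′ = Y.F-above p∈yp′

  same-removed : ∀ {p q q′} b → f r n x p ≡ f r n y p →
                 X.parent b ≡ just (p , q) → Y.parent b ≡ just (p , q′) → q ≡ q′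
  same-removed {p} {q} {q′} b fx≡fy ex ey with q Finₚ.≟ q′
  ... | yes q≡q′ = q≡q′
  ... | no  q≢q′ = contradiction (F-⊆ same removed∈xb) (Y.removed∉F b ey)
    where
    removed = lookup (f r n y p) q′
    removed∈xb : removed X.∈F b
    removed∈xb = X.∈F-child⁺ b ex (subst (λ v → removed ∈ toList v) (sym fx≡fy) (lookup∈toList (f r n y p) q′))
      (λ eq → q≢q′ (sym (lookup-injective (f r n y p) (Y.F-unique p)
                                          (trans eq (cong (λ v → lookup v q) fx≡fy)))))

  f≡⇒parent-≡ : ∀ b → (∀ {p q} → X.parent b ≡ just (p , q) → f r n x p ≡ f r n y p) →
                X.parent b ≡ Y.parent b
  f≡⇒parent-≡ b f-agrees with X.parent b in ex | Y.parent b in ey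
  ... | nothing      | nothing        = refl
  ... | nothing      | just (p′ , q′) = contradiction (F-⊆ (sameGraph-sym same) (Y.parent∈F b ey)) (X.v∉F-root b ex)
  ... | just (p , q) | nothing        = contradiction (F-⊆ same (X.parent∈F b ex)) (Y.v∉F-root b ey)
  ... | just (p , q) | just (p′ , q′) with same-parent b ex ey
  ...   | refl = cong (λ t → just (p , t)) (same-removed b (f-agrees refl) ex ey)

  f-≡ : ∀ b → f r n x b ≡ f r n y b
  f-≡ b = go (X.⊐-wellFounded b)
    where
    go : ∀ {b} → Acc X._⊐_ b → f r n x b ≡ f r n y b
    go {b} (acc rec) = unfold (f≡⇒parent-≡ b (λ ex → go (rec (X.parent-above b ex))))
      where
      unfold : X.parent b ≡ Y.parent b → f r n x b ≡ f r n y b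
      unfold parents with X.parent b in ex
      ... | nothing      = trans (X.f-root b ex) (sym (Y.f-root b (sym parents)))
      ... | just (p , q) = trans (X.f-child b ex)
                             (trans (cong (λ v → shiftIn r v q (inj₂ p)) (go (rec (X.parent-above b ex))))
                                    (sym (Y.f-child b (sym parents))))

  parent-≡ : ∀ b → X.parent b ≡ Y.parent b
  parent-≡ b = f≡⇒parent-≡ b (λ {p} _ → f-≡ p)

  module _ (generic-x : InComplement r n x) (generic-y : InComplement r n y) where

    ⊕-agree : ∀ {a b A B} → a ≢ b → Agree r x y a b → Agree r x y b a → Window r a b A B →
              b X.⊕ A < a X.⊕ B ⇔ b Y.⊕ A < a Y.⊕ B
    ⊕-agree a≢b agree-ab agree-ba win = mk⇔
      (⊕-transfer r x y generic-y a≢b agree-ab agree-ba win)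
      (⊕-transfer r y x generic-x a≢b (⇔.sym ∘ agree-ab) (⇔.sym ∘ agree-ba) win)

    views-agree : ∀ {i j} → i ≢ j → Agree r x y i j
    views-agree {i} {j} = go (<-wellFounded (X.rank j ℕ.+ X.rank i))
      where
      go : ∀ {i j} → Acc ℕ._<_ (X.rank j ℕ.+ X.rank i) → i ≢ j → Agree r x y i j
      go {i} {j} (acc rec) i≢j k = by-parent (parent-≡ j)
        where
        by-parent : X.parent j ≡ Y.parent j → 0ℚ < c r n x i j k ⇔ 0ℚ < c r n y i j k
        by-parent parents with X.parent j in ex
        ... | nothing = mk⇔ (⊥-elim ∘ X.parent-root j ex i k) (⊥-elim ∘ Y.parent-root j (sym parents) i k)
        ... | just (p , q) with i Finₚ.≟ p
        ...   | yes refl = ⇔.trans (X.c-parent⇔ j ex) (⇔.sym (Y.c-parent⇔ j (sym parents)))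
        ...   | no  i≢p  = begin
          0ℚ < c r n x i j k
            ≈⟨ X.Generic.c-via-parent⇔ generic-x j ex i≢p i≢j ⟩
          p X.⊕ (bump p j ℕ.+ suc (toℕ k)) < i X.⊕ (bump i j ℕ.+ suc (toℕ q))
            ≈⟨ ⊕-agree i≢p (go (rec p+i<j+i) i≢p) (go (rec i+p<j+i) (≢-sym i≢p)) (window-parent j k q) ⟩
          p Y.⊕ (bump p j ℕ.+ suc (toℕ k)) < i Y.⊕ (bump i j ℕ.+ suc (toℕ q))
            ≈⟨ Y.Generic.c-via-parent⇔ generic-y j (sym parents) i≢p i≢j ⟨
          0ℚ < c r n y i j k
            ∎
          where
          open ⇔-Reasoning
          p+i<j+i : X.rank p ℕ.+ X.rank i ℕ.< X.rank j ℕ.+ X.rank i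
          p+i<j+i = ℕₚ.+-monoˡ-< (X.rank i) (X.rank-< (X.parent-above j ex))
          i+p<j+i : X.rank i ℕ.+ X.rank p ℕ.< X.rank j ℕ.+ X.rank i
          i+p<j+i = subst (ℕ._< X.rank j ℕ.+ X.rank i) (ℕₚ.+-comm (X.rank p) (X.rank i)) p+i<j+i

    same-region : SameRegion r n x y
    same-region i j i<j a shi = begin
      x i - x j < ℤtoℚ a
        ≈⟨ X.hyperplane-side⇔ i j a ⟩
      i X.⊕ negPart a < j X.⊕ posPart a
        ≈⟨ ⊕-agree j≢i (views-agree j≢i) (views-agree i≢j) (window-hyperplane i<j shi) ⟩
      i Y.⊕ negPart a < j Y.⊕ posPart a
        ≈⟨ Y.hyperplane-side⇔ i j a ⟨
      y i - y j < ℤtoℚ a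
        ∎
      where
      open ⇔-Reasoning
      i≢j = Finₚ.<⇒≢ i<j
      j≢i = ≢-sym i≢j

proposition4p5 : (r n : ℕ) → 0 ℕ.< r → 0 ℕ.< n →
    (x y : Point n) → InComplement r n x → InComplement r n y →
    SameGraph r n x y → SameRegion r n x y
proposition4p5 r n _ _ x y generic-x generic-y same = same-region same generic-x generic-y
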